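{- Let $a,b$ be positive integers. If $a\neq b$, then for every $G\in\{\sigma(a),\beta(a),\delta(a)\}$ and every $H\in\{\sigma(b),\beta(b),\delta(b)\}$, the number of isotemporal classes of the stem structure $S(G,H)$ is $\mathcal{N}(S(G,H))=ab+a+b+1$. If $a=b$, then $\mathcal{N}(S(\sigma(a),\sigma(a)))=\mathcal{N}(S(\delta(a),\delta(a)))=\mathcal{N}(S(\beta(a),\beta(a)))=\frac{1}{2}(a^2+3a+2)$.
   Context: Pseudographs (finite, loops and multiple edges allowed) are considered. A temporal network is a pseudograph together with a bijection $\tau$ from its edge set to $\{1,2,\ldots,t\}$, $t$ the number of edges. A temporal path is a sequence of edges $e_1,\ldots,e_k$ forming a walk $v_1,v_2,\ldots,v_{k+1}$ (edge $e_i$ joins $v_i$ and $v_{i+1}$; a loop at $v$ joins $v$ to itself) with $\tau(e_1)<\tau(e_2)<\cdots<\tau(e_k)$. Two temporal networks are temporally isomorphic if there is an isomorphism of the underlying pseudographs mapping every temporal path of the first to a temporal path of the second; an isotemporal class is an equivalence class under temporal isomorphism, and $\mathcal{N}(X)$ is the number of isotemporal classes among all temporal labelings of the pseudograph $X$. The star $\sigma(k)$ is the tree with one center vertex and $k$ leaves adjacent to it ($k$ edges). The beachball $\beta(k)$ is the pseudograph with two vertices joined by $k$ parallel edges. The daisy $\delta(k)$ is the pseudograph with a single vertex and $k$ loops at it. For $G,H$ each a star, beachball or daisy, the stem structure $S(G,H)$ is obtained from disjoint copies of $G$ and $H$ by adding one edge joining a designated vertex of $G$ to a designated vertex of $H$,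 where the designated vertex is the center of a star, the unique vertex of a daisy, or one (fixed) of the two vertices of a beachball. In particular $S(\sigma(a),\sigma(b))$ is the diaster: two adjacent vertices with $a$ and $b$ degree-one neighbours attached respectively. -}

module Defs where

open import Data.Nat using (ℕ; zero; suc; _+_)
open import Data.Fin using (Fin; zero; suc; _<_; _↑ˡ_; _↑ʳ_; splitAt)
open import Data.Fin.Permutation using (Permutation; Permutation′; _⟨$⟩ʳ_)
open import Data.Product using (Σ; ∃; ∃₂; _×_; _,_; proj₁; proj₂)
open import Data.Sum using (_⊎_; inj₁; inj₂)
open import Data.List using (List; []; _∷_; map)
open import Data.List.Relation.Unary.Linked using (Linked)
open import Relation.Binary.PropositionalEquality using (_≡_)

-- A finite pseudograph: vertices Fin nV, edges Fin nE, and each edge has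
-- an (unordered) pair of end vertices, stored as an ordered pair.
-- A loop is an edge whose two ends coincide; parallel edges are allowed.
record Pseudograph : Set where
  field
    nV   : ℕ
    nE   : ℕ
    ends : Fin nE → Fin nV × Fin nV
open Pseudograph public

Vertex : Pseudograph → Set
Vertex X = Fin (nV X)

Edge : Pseudograph → Set
Edge X = Fin (nE X)

Joins : (X : Pseudograph) → Edge X → Vertex X → Vertex X → Set
Joins X e u w = (ends X e ≡ (u , w)) ⊎ (ends X e ≡ (w , u))

data Walk (X : Pseudograph) : Vertex X → List (Edge X) → Vertex X → Set where
  nil  : ∀ {v} → Walk X v [] v
  cons : ∀ {u w v e es} → Joins X e u w → Walk X w es v → Walk X u (e ∷ es) v

-- temporal labeling: bijection from edges to {1..t} (here Fin t, t = #edges)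
Labeling : Pseudograph → Set
Labeling X = Permutation′ (nE X)

TemporalPath : (X : Pseudograph) → Labeling X → List (Edge X) → Set
TemporalPath X τ es =
  Linked (λ e f → (τ ⟨$⟩ʳ e) < (τ ⟨$⟩ʳ f)) es × ∃₂ (λ u v → Walk X u es v)

record Iso (X Y : Pseudograph) : Set where
  field
    φ   : Permutation (nV X) (nV Y)
    ψ   : Permutation (nE X) (nE Y)
    inc : ∀ e → Joins Y (ψ ⟨$⟩ʳ e) (φ ⟨$⟩ʳ proj₁ (ends X e)) (φ ⟨$⟩ʳ proj₂ (ends X e))
open Iso public

TemporallyIsomorphic : (X : Pseudograph) → Labeling X → Labeling X → Set
TemporallyIsomorphic X τ₁ τ₂ =
  Σ (Iso X X) λ f → ∀ es → TemporalPath X τ₁ es → TemporalPath X τ₂ (map (ψ f ⟨$⟩ʳ_) es)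

-- 𝒩(X) = N : there are N labelings, pairwise not temporally isomorphic,
-- such that every labeling is temporally isomorphic to one of them
-- (i.e. N is the number of isotemporal classes).
NumClasses : Pseudograph → ℕ → Set
NumClasses X N =
  Σ (Fin N → Labeling X) λ rep →
    (∀ i j → TemporallyIsomorphic X (rep i) (rep j) → i ≡ j) ×
    (∀ τ → ∃ λ i → TemporallyIsomorphic X τ (rep i))

record Pointed : Set where
  field
    graph : Pseudograph
    point : Vertex graph
open Pointed public

data Shape : Set where
  star beachball daisy : Shape

-- σ(k): center 0, leaves suc i; β(k): vertices 0,1 with k parallel edges;
-- δ(k): one vertex with k loops.  Designated vertex is 0 in each case.
shapeGraph : Shape → ℕ → Pseudograph
shapeGraph star      k = record { nV = suc k ; nE = k ; ends = λ i → (zero , suc i) }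
shapeGraph beachball k = record { nV = 2 ; nE = k ; ends = λ i → (zero , suc zero) }
shapeGraph daisy     k = record { nV = 1 ; nE = k ; ends = λ i → (zero , zero) }

σβδ : Shape → ℕ → Pointed
σβδ s k = record { graph = shapeGraph s k ; point = vzero s k }
  where
  vzero : (s : Shape) (k : ℕ) → Vertex (shapeGraph s k)
  vzero star      k = zero
  vzero beachball k = zero
  vzero daisy     k = zero

-- stem structure S(G,H): disjoint union plus one edge (edge 0) joining the
-- designated vertices
Stem : Pointed → Pointed → Pseudograph
Stem G H = record { nV = nV g + nV h ; nE = suc (nE g + nE h) ; ends = en }
  where
  g = graph G
  h = graph H
  en : Fin (suc (nE g + nE h)) → Fin (nV g + nV h) × Fin (nV g + nV h)
  en zero = (point G ↑ˡ nV h , nV g ↑ʳ point H)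
  en (suc i) with splitAt (nE g) i
  ... | inj₁ e = (proj₁ (ends g e) ↑ˡ nV h , proj₂ (ends g e) ↑ˡ nV h)
  ... | inj₂ e = (nV g ↑ʳ proj₁ (ends h e) , nV g ↑ʳ proj₂ (ends h e))

-- Label the stem of S(G,H) and count the edges of G and of H that carry a
-- smaller label; call these numbers i ≤ a and j ≤ b.  Since every edge of a
-- star, beachball or daisy meets the designated vertex, and every permutation
-- of its edges is induced by an automorphism fixing that vertex, the temporal
-- paths of a labeling are determined by (i, j): permuting the edges of G and
-- of H into label order is a temporal isomorphism onto a canonical labeling
-- that depends on (i, j) only.  Conversely (i, j) is an invariant: an
-- automorphism fixes the stem, the only edge adjacent to all others, and
-- either preserves or (only if a = b) exchanges the two sides, so it preserves
-- or exchanges i and j.  Hence there are (a+1)(b+1) classes when a ≠ b, and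
-- when G = H the pairs (i, j) and (j, i) merge, leaving (a+1)(a+2)/2 classes.
module Submission where

open import Defs
open import Data.Nat using (ℕ; _+_; _*_; _^_; _≤_; _/_)
open import Data.Product using (_×_)
open import Relation.Binary.PropositionalEquality using (_≡_; _≢_)

open import Data.Bool using (if_then_else_)
open import Data.Fin as F using (Fin; toℕ; fromℕ<; punchOut; splitAt; _↑ˡ_; _↑ʳ_; combine; remQuot)
open import Data.Fin.Permutation as Perm using
  (Permutation; Permutation′; _⟨$⟩ʳ_; _⟨$⟩ˡ_; permutation; inverseˡ; inverseʳ; _∘ₚ_; lift₀)
open import Data.Fin.Properties as FP using
  (+↔⊎; splitAt-↑ˡ; splitAt-↑ʳ; toℕ-fromℕ<; toℕ-injective)
open import Data.List using ([]; _∷_; map)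
open import Data.List.Properties using (map-∘)
open import Data.List.Relation.Unary.Linked using (Linked; []; [-]; _∷_)
open import Data.Nat using (zero; suc; _<_; _<?_; z≤n; s≤s)
open import Data.Nat.DivMod using (m*n/n≡m)
open import Data.Nat.Properties
open import Algebra.Properties.CommutativeMonoid.Sum +-0-commutativeMonoid using (sum; sum-permute)
open import Data.Nat.Tactic.RingSolver using (solve-∀)
open import Data.Product using (Σ; ∃; _,_; proj₁; proj₂)
open import Data.Sum using (_⊎_; inj₁; inj₂; [_,_]′; map₂)
open import Data.Sum.Algebra using (⊎-comm)
open import Data.Sum.Function.Propositional using (_⊎-↔_)
open import Function using (_∘_; const)
open import Function.Definitions using (Injective)
open import Function.Properties.Inverse using (↔-trans; ↔-sym)
open import Level using (Level)
open import Relation.Binary.Definitions using (DecidableEquality; tri<; tri≈; tri>)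
open import Relation.Binary.PropositionalEquality
  using (refl; sym; trans; cong; cong₂; subst; subst₂; module ≡-Reasoning)
open import Relation.Nullary using (¬_; Dec; yes; no; does; contradiction)
open import Relation.Nullary.Decidable using (_×-dec_; _⊎-dec_; decidable-stable)
open import Relation.Unary using (Pred; Decidable; _⊆_)
open import Relation.Unary.Properties using (U?)

private
  variable
    m m′ n n′ : ℕ
    p q : Level

⟨$⟩ʳ-injective : (π : Permutation m n) → Injective _≡_ _≡_ (π ⟨$⟩ʳ_)
⟨$⟩ʳ-injective π {x} {y} eq = begin
  x                   ≡⟨ inverseˡ π ⟨
  π ⟨$⟩ˡ (π ⟨$⟩ʳ x)   ≡⟨ cong (π ⟨$⟩ˡ_) eq ⟩
  π ⟨$⟩ˡ (π ⟨$⟩ʳ y)   ≡⟨ inverseˡ π ⟩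
  y                   ∎
  where open ≡-Reasoning

injective⇒surjective : (f : Fin n → Fin n) → Injective _≡_ _≡_ f → ∀ y → ∃ λ x → f x ≡ y
injective⇒surjective {suc n} f f-inj y with FP.any? (λ x → f x F.≟ y)
... | yes hit = hit
... | no miss = contradiction (FP.injective⇒≤ {f = squeeze} squeeze-injective) (<-irrefl refl)
  where
  squeeze : Fin (suc n) → Fin n
  squeeze x = punchOut {i = y} {j = f x} (λ eq → miss (x , sym eq))
  squeeze-injective : Injective _≡_ _≡_ squeeze
  squeeze-injective {x} {x′} eq =
    f-inj (FP.punchOut-injective (λ e → miss (x , sym e)) (λ e → miss (x′ , sym e)) eq)

-- Kept abstract: otherwise Agda unfolds the surjectivity proof whenever it
-- compares two labelings built from injections, which is prohibitively slow.
abstract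
  fromInjection : (f : Fin n → Fin n) → Injective _≡_ _≡_ f → Permutation′ n
  fromInjection f f-inj =
    permutation f (proj₁ ∘ surj) (proj₂ ∘ surj) (λ x → f-inj (proj₂ (surj (f x))))
    where
    surj : ∀ y → ∃ λ x → f x ≡ y
    surj = injective⇒surjective f f-inj

  fromInjection-apply : (f : Fin n → Fin n) (f-inj : Injective _≡_ _≡_ f) →
                        ∀ x → fromInjection f f-inj ⟨$⟩ʳ x ≡ f x
  fromInjection-apply f f-inj x = refl

label : Permutation′ n → Fin n → ℕ
label τ e = toℕ (τ ⟨$⟩ʳ e)

label-injective : (τ : Permutation′ n) → ∀ {e e′} → label τ e ≡ label τ e′ → e ≡ e′
label-injective τ eq = ⟨$⟩ʳ-injective τ (toℕ-injective eq)

data Split (m n : ℕ) : Fin (m + n) → Set where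
  inl : (x : Fin m) → Split m n (x ↑ˡ n)
  inr : (y : Fin n) → Split m n (m ↑ʳ y)

split : ∀ m n k → Split m n k
split m n k with splitAt m k in eq
... | inj₁ x = subst (Split m n) (FP.splitAt⁻¹-↑ˡ eq) (inl x)
... | inj₂ y = subst (Split m n) (FP.splitAt⁻¹-↑ʳ eq) (inr y)

_⊕ₚ_ : Permutation m m′ → Permutation n n′ → Permutation (m + n) (m′ + n′)
π ⊕ₚ ρ = ↔-trans +↔⊎ (↔-trans (π ⊎-↔ ρ) (↔-sym +↔⊎))

⊕ₚ-↑ˡ : (π : Permutation m m′) (ρ : Permutation n n′) (x : Fin m) →
        (π ⊕ₚ ρ) ⟨$⟩ʳ (x ↑ˡ n) ≡ (π ⟨$⟩ʳ x) ↑ˡ n′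
⊕ₚ-↑ˡ {m} {n = n} π ρ x rewrite splitAt-↑ˡ m x n = refl

⊕ₚ-↑ʳ : (π : Permutation m m′) (ρ : Permutation n n′) (y : Fin n) →
        (π ⊕ₚ ρ) ⟨$⟩ʳ (m ↑ʳ y) ≡ m′ ↑ʳ (ρ ⟨$⟩ʳ y)
⊕ₚ-↑ʳ {m} {n = n} π ρ y rewrite splitAt-↑ʳ m n y = refl

swapₚ : ∀ m n → Permutation (m + n) (n + m)
swapₚ m n = ↔-trans +↔⊎ (↔-trans (⊎-comm (Fin m) (Fin n)) (↔-sym +↔⊎))

swapₚ-↑ˡ : ∀ {m} n (x : Fin m) → swapₚ m n ⟨$⟩ʳ (x ↑ˡ n) ≡ n ↑ʳ x
swapₚ-↑ˡ {m} n x rewrite splitAt-↑ˡ m x n = refl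

swapₚ-↑ʳ : ∀ m {n} (y : Fin n) → swapₚ m n ⟨$⟩ʳ (m ↑ʳ y) ≡ y ↑ˡ m
swapₚ-↑ʳ m {n} y rewrite splitAt-↑ʳ m n y = refl

indicator : {A : Set p} → Dec A → ℕ
indicator (yes _) = 1
indicator (no _)  = 0

indicator-no : {A : Set p} (d : Dec A) → ¬ A → indicator d ≡ 0
indicator-no (yes a) ¬a = contradiction a ¬a
indicator-no (no _)  _  = refl

count : {P : Pred (Fin n) p} → Decidable P → ℕ
count P? = sum (λ x → indicator (P? x))

count-mono : {P : Pred (Fin n) p} {Q : Pred (Fin n) q} (P? : Decidable P) (Q? : Decidable Q) →
             P ⊆ Q → count P? ≤ count Q?
count-mono {n = zero}  P? Q? P⊆Q = z≤n
count-mono {n = suc n} P? Q? P⊆Q with P? F.zero | Q? F.zero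
... | yes _ | yes _  = s≤s (count-mono (P? ∘ F.suc) (Q? ∘ F.suc) P⊆Q)
... | yes p | no ¬q  = contradiction (P⊆Q p) ¬q
... | no _  | yes _  = m≤n⇒m≤1+n (count-mono (P? ∘ F.suc) (Q? ∘ F.suc) P⊆Q)
... | no _  | no _   = count-mono (P? ∘ F.suc) (Q? ∘ F.suc) P⊆Q

count-mono-< : {P : Pred (Fin n) p} {Q : Pred (Fin n) q} (P? : Decidable P) (Q? : Decidable Q) →
               P ⊆ Q → ∀ x → Q x → ¬ P x → count P? < count Q?
count-mono-< P? Q? P⊆Q F.zero qx ¬px with P? F.zero | Q? F.zero
... | yes px | _      = contradiction px ¬px
... | no _   | yes _  = s≤s (count-mono (P? ∘ F.suc) (Q? ∘ F.suc) P⊆Q)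
... | no _   | no ¬q  = contradiction qx ¬q
count-mono-< P? Q? P⊆Q (F.suc x) qx ¬px with P? F.zero | Q? F.zero
... | yes _ | yes _  = s≤s (count-mono-< (P? ∘ F.suc) (Q? ∘ F.suc) P⊆Q x qx ¬px)
... | yes p | no ¬q  = contradiction (P⊆Q p) ¬q
... | no _  | yes _  = m<n⇒m<1+n (count-mono-< (P? ∘ F.suc) (Q? ∘ F.suc) P⊆Q x qx ¬px)
... | no _  | no _   = count-mono-< (P? ∘ F.suc) (Q? ∘ F.suc) P⊆Q x qx ¬px

count-cong : {P : Pred (Fin n) p} {Q : Pred (Fin n) q} (P? : Decidable P) (Q? : Decidable Q) →
             P ⊆ Q → Q ⊆ P → count P? ≡ count Q?
count-cong P? Q? P⊆Q Q⊆P = ≤-antisym (count-mono P? Q? P⊆Q) (count-mono Q? P? Q⊆P)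

count-all : {P : Pred (Fin n) p} (P? : Decidable P) → (∀ x → P x) → count P? ≡ n
count-all {n = zero}  P? all = refl
count-all {n = suc n} P? all with P? F.zero
... | yes _ = cong suc (count-all (P? ∘ F.suc) (all ∘ F.suc))
... | no ¬p = contradiction (all F.zero) ¬p

count-none : {P : Pred (Fin n) p} (P? : Decidable P) → (∀ x → ¬ P x) → count P? ≡ 0
count-none {n = zero}  P? none = refl
count-none {n = suc n} P? none with P? F.zero
... | yes p = contradiction p (none F.zero)
... | no _  = count-none (P? ∘ F.suc) (none ∘ F.suc)

count-const : {A : Set p} (d : Dec A) → count {n} (λ _ → d) ≡ (if does d then n else 0)
count-const {n = zero}  (yes _) = refl
count-const {n = zero}  (no _)  = refl
count-const {n = suc n} (yes a) = cong suc (count-const {n = n} (yes a))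
count-const {n = suc n} (no ¬a) = count-const {n = n} (no ¬a)

count-≤ : {P : Pred (Fin n) p} (P? : Decidable P) → count P? ≤ n
count-≤ P? = subst (count P? ≤_) (count-all U? _) (count-mono P? U? _)

count-< : {P : Pred (Fin n) p} (P? : Decidable P) → ∀ x → ¬ P x → count P? < n
count-< P? x ¬px = subst (count P? <_) (count-all U? _) (count-mono-< P? U? _ x _ ¬px)

count-+ : {P : Pred (Fin (m + n)) p} (P? : Decidable P) →
          count P? ≡ count (P? ∘ (_↑ˡ n)) + count (P? ∘ (m ↑ʳ_))
count-+ {m = zero}      P? = refl
count-+ {m = suc m} {n} P? = trans (cong (indicator (P? F.zero) +_) (count-+ {m = m} {n} (P? ∘ F.suc)))
  (sym (+-assoc (indicator (P? F.zero)) _ _))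

count-permute : {P : Pred (Fin n) p} (P? : Decidable P) (π : Permutation m n) →
                count P? ≡ count (P? ∘ (π ⟨$⟩ʳ_))
count-permute P? π = sum-permute (λ x → indicator (P? x)) π

count-toℕ< : ∀ {i} → i ≤ n → count (λ (x : Fin n) → toℕ x <? i) ≡ i
count-toℕ< {n = zero}  {zero}  z≤n = refl
count-toℕ< {n = suc n} {zero}  _   = count-none (λ (x : Fin (suc n)) → toℕ x <? 0) (λ _ ())
count-toℕ< {n = suc n} {suc i} (s≤s i≤n) = cong suc (begin
  count (λ (x : Fin n) → suc (toℕ x) <? suc i)
    ≡⟨ count-cong {n = n} (λ x → suc (toℕ x) <? suc i) (λ x → toℕ x <? i) ≤-pred s≤s ⟩
  count (λ (x : Fin n) → toℕ x <? i)
    ≡⟨ count-toℕ< i≤n ⟩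
  i ∎)
  where open ≡-Reasoning

module Rank {n : ℕ} (key : Fin n → ℕ) where

  infix 4 _≺_

  _≺_ : Fin n → Fin n → Set
  x ≺ y = key x < key y ⊎ (key x ≡ key y × x F.< y)

  _≺?_ : ∀ x y → Dec (x ≺ y)
  x ≺? y = (key x <? key y) ⊎-dec ((key x ≟ key y) ×-dec (x F.<? y))

  ≺-irrefl : ∀ {x} → ¬ x ≺ x
  ≺-irrefl (inj₁ lt)       = <-irrefl refl lt
  ≺-irrefl (inj₂ (_ , lt)) = <-irrefl refl lt

  ≺-trans : ∀ {x y z} → x ≺ y → y ≺ z → x ≺ z
  ≺-trans (inj₁ lt)        (inj₁ lt′)         = inj₁ (<-trans lt lt′)
  ≺-trans (inj₁ lt)        (inj₂ (eq′ , _))   = inj₁ (<-≤-trans lt (≤-reflexive eq′))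
  ≺-trans (inj₂ (eq , _))  (inj₁ lt′)         = inj₁ (≤-<-trans (≤-reflexive eq) lt′)
  ≺-trans (inj₂ (eq , lt)) (inj₂ (eq′ , lt′)) = inj₂ (trans eq eq′ , <-trans lt lt′)

  ≺-connex : ∀ {x y} → x ≢ y → x ≺ y ⊎ y ≺ x
  ≺-connex {x} {y} x≢y with <-cmp (key x) (key y)
  ... | tri< lt _ _ = inj₁ (inj₁ lt)
  ... | tri> _ _ gt = inj₂ (inj₁ gt)
  ... | tri≈ _ eq _ with FP.<-cmp x y
  ...   | tri< lt _ _  = inj₁ (inj₂ (eq , lt))
  ...   | tri≈ _ x≡y _ = contradiction x≡y x≢y
  ...   | tri> _ _ gt  = inj₂ (inj₂ (sym eq , gt))

  ≤∧<⇒≺ : ∀ {x y} → key x ≤ key y → x F.< y → x ≺ y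
  ≤∧<⇒≺ key≤ x<y with m≤n⇒m<n∨m≡n key≤
  ... | inj₁ key< = inj₁ key<
  ... | inj₂ key≡ = inj₂ (key≡ , x<y)

  rankCount : Fin n → ℕ
  rankCount x = count (_≺? x)

  rankCount<n : ∀ x → rankCount x < n
  rankCount<n x = count-< (_≺? x) x ≺-irrefl

  rankCount-mono : ∀ {x y} → x ≺ y → rankCount x < rankCount y
  rankCount-mono {x} {y} x≺y =
    count-mono-< (_≺? x) (_≺? y) (λ z≺x → ≺-trans z≺x x≺y) x x≺y ≺-irrefl

  rankCount-injective : ∀ {x y} → rankCount x ≡ rankCount y → x ≡ y
  rankCount-injective {x} {y} eq with x F.≟ y
  ... | yes x≡y = x≡y
  ... | no x≢y with ≺-connex x≢y
  ...   | inj₁ x≺y = contradiction eq (<⇒≢ (rankCount-mono x≺y))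
  ...   | inj₂ y≺x = contradiction eq (>⇒≢ (rankCount-mono y≺x))

  rankPerm : Permutation′ n
  rankPerm = fromInjection rank rank-injective
    where
    rank : Fin n → Fin n
    rank x = fromℕ< (rankCount<n x)
    rank-injective : Injective _≡_ _≡_ rank
    rank-injective {x} {y} eq = rankCount-injective
      (trans (sym (toℕ-fromℕ< (rankCount<n x))) (trans (cong toℕ eq) (toℕ-fromℕ< (rankCount<n y))))

  label-rankPerm : ∀ x → label rankPerm x ≡ rankCount x
  label-rankPerm x = trans (cong toℕ (fromInjection-apply _ _ x)) (toℕ-fromℕ< (rankCount<n x))

  rankPerm-mono : ∀ {x y} → x ≺ y → label rankPerm x < label rankPerm y
  rankPerm-mono {x} {y} x≺y =
    subst₂ _<_ (sym (label-rankPerm x)) (sym (label-rankPerm y)) (rankCount-mono x≺y)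

  rankPerm-reflects : ∀ {x y} → label rankPerm x < label rankPerm y → x ≺ y
  rankPerm-reflects {x} {y} lt with x F.≟ y
  ... | yes refl = contradiction lt (<-irrefl refl)
  ... | no x≢y with ≺-connex x≢y
  ...   | inj₁ x≺y = x≺y
  ...   | inj₂ y≺x = contradiction lt (<-asym (rankPerm-mono y≺x))

  rankPerm-below : ∀ {x t} → key x < t → label rankPerm x < count (λ y → key y <? t)
  rankPerm-below {x} {t} lt = subst (_< count (λ y → key y <? t)) (sym (label-rankPerm x))
    (count-mono-< (_≺? x) (λ y → key y <? t) below x lt ≺-irrefl)
    where
    below : ∀ {y} → y ≺ x → key y < t
    below (inj₁ lt′)      = <-trans lt′ lt
    below (inj₂ (eq , _)) = ≤-<-trans (≤-reflexive eq) lt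

  rankPerm-above : ∀ {x t} → t ≤ key x → count (λ y → key y <? t) ≤ label rankPerm x
  rankPerm-above {x} {t} le = subst (count (λ y → key y <? t) ≤_) (sym (label-rankPerm x))
    (count-mono (λ y → key y <? t) (_≺? x) (λ lt → inj₁ (<-≤-trans lt le)))

-- Temporal isomorphisms

Joins-sym : ∀ {X e u w} → Joins X e u w → Joins X e w u
Joins-sym (inj₁ eq) = inj₂ eq
Joins-sym (inj₂ eq) = inj₁ eq

data Adjacent (X : Pseudograph) (e f : Edge X) : Set where
  adjacent : ∀ {u w z} → Joins X e u w → Joins X f w z → Adjacent X e f

Adjacent-sym : ∀ {X e f} → Adjacent X e f → Adjacent X f e
Adjacent-sym {X} (adjacent j j′) = adjacent (Joins-sym {X} j′) (Joins-sym {X} j)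

Iso-Joins : ∀ {X Y} (f : Iso X Y) → ∀ {e u w} → Joins X e u w →
            Joins Y (ψ f ⟨$⟩ʳ e) (φ f ⟨$⟩ʳ u) (φ f ⟨$⟩ʳ w)
Iso-Joins         f {e} (inj₁ refl) = inc f e
Iso-Joins {Y = Y} f {e} (inj₂ refl) = Joins-sym {Y} (inc f e)

Iso-Adjacent : ∀ {X Y} (f : Iso X Y) → ∀ {e e′} → Adjacent X e e′ →
               Adjacent Y (ψ f ⟨$⟩ʳ e) (ψ f ⟨$⟩ʳ e′)
Iso-Adjacent f (adjacent j j′) = adjacent (Iso-Joins f j) (Iso-Joins f j′)

Iso-∘ : ∀ {X Y Z} → Iso X Y → Iso Y Z → Iso X Z
Iso-∘ f g = record { φ = φ f ∘ₚ φ g ; ψ = ψ f ∘ₚ ψ g ; inc = λ e → Iso-Joins g (inc f e) }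

MapsTemporalPaths : (X : Pseudograph) → Labeling X → Labeling X → Iso X X → Set
MapsTemporalPaths X τ ρ f =
  ∀ es → TemporalPath X τ es → TemporalPath X ρ (map (ψ f ⟨$⟩ʳ_) es)

PreservesAdjacentOrder : (X : Pseudograph) → Labeling X → Labeling X → Iso X X → Set
PreservesAdjacentOrder X τ ρ f = ∀ {e e′} → Adjacent X e e′ →
  label τ e < label τ e′ → label ρ (ψ f ⟨$⟩ʳ e) < label ρ (ψ f ⟨$⟩ʳ e′)

adjacentOrder⇒temporalPaths : ∀ {X τ ρ} (f : Iso X X) →
  PreservesAdjacentOrder X τ ρ f → MapsTemporalPaths X τ ρ f
adjacentOrder⇒temporalPaths {X} {τ} {ρ} f preserves es (increasing , _ , _ , walk) =
  proj₁ (image walk increasing) , _ , _ , proj₂ (image walk increasing)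
  where
  image : ∀ {u es v} → Walk X u es v → Linked (λ e e′ → label τ e < label τ e′) es →
          Linked (λ e e′ → label ρ e < label ρ e′) (map (ψ f ⟨$⟩ʳ_) es) ×
          Walk X (φ f ⟨$⟩ʳ u) (map (ψ f ⟨$⟩ʳ_) es) (φ f ⟨$⟩ʳ v)
  image nil                    []         = [] , nil
  image (cons j nil)           [-]        = [-] , cons (Iso-Joins f j) nil
  image (cons j w@(cons j′ _)) (lt ∷ lts) with image w lts
  ... | lts′ , w′ = preserves (adjacent j j′) lt ∷ lts′ , cons (Iso-Joins f j) w′

temporalPaths⇒adjacentOrder : ∀ {X τ ρ} (f : Iso X X) →
  MapsTemporalPaths X τ ρ f → PreservesAdjacentOrder X τ ρ f
temporalPaths⇒adjacentOrder f maps {e} {e′} (adjacent j j′) lt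
  with maps (e ∷ e′ ∷ []) ((lt ∷ [-]) , _ , _ , cons j (cons j′ nil))
... | (lt′ ∷ _) , _ = lt′

≅ₜ-trans : ∀ {X τ₁ τ₂ τ₃} → TemporallyIsomorphic X τ₁ τ₂ →
           TemporallyIsomorphic X τ₂ τ₃ → TemporallyIsomorphic X τ₁ τ₃
≅ₜ-trans {X} {τ₃ = τ₃} (f , f-maps) (g , g-maps) =
  Iso-∘ f g , λ es path → subst (TemporalPath X τ₃) (sym (map-∘ es)) (g-maps _ (f-maps es path))

-- Stem structures

record PointedIso (G H : Pointed) : Set where
  field
    iso             : Iso (graph G) (graph H)
    point-preserved : φ iso ⟨$⟩ʳ point G ≡ point H
open PointedIso

EdgesAtPoint : Pointed → Set
EdgesAtPoint G = ∀ e → proj₁ (ends (graph G) e) ≡ point G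

EdgeSymmetric : Pointed → Set
EdgeSymmetric G = ∀ (π : Permutation′ (nE (graph G))) →
  Σ (PointedIso G G) λ f → ∀ e → ψ (iso f) ⟨$⟩ʳ e ≡ π ⟨$⟩ʳ e

data Part : Set where
  stemᵖ leftᵖ rightᵖ : Part

module StemStructure (G H : Pointed) where

  A = nE (graph G)
  B = nE (graph H)
  P = nV (graph G)
  Q = nV (graph H)
  X = Stem G H

  private
    g = graph G
    h = graph H

  stem : Edge X
  stem = F.zero

  left : Fin A → Edge X
  left x = F.suc (x ↑ˡ B)

  right : Fin B → Edge X
  right y = F.suc (A ↑ʳ y)

  data EdgeView : Edge X → Set where
    stemᵛ  : EdgeView stem
    leftᵛ  : ∀ x → EdgeView (left x)
    rightᵛ : ∀ y → EdgeView (right y)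

  edgeView : ∀ e → EdgeView e
  edgeView F.zero = stemᵛ
  edgeView (F.suc k) with split A B k
  ... | inl x = leftᵛ x
  ... | inr y = rightᵛ y

  ends-left : ∀ x → ends X (left x) ≡ (proj₁ (ends g x) ↑ˡ Q , proj₂ (ends g x) ↑ˡ Q)
  ends-left x rewrite splitAt-↑ˡ A x B = refl

  ends-right : ∀ y → ends X (right y) ≡ (P ↑ʳ proj₁ (ends h y) , P ↑ʳ proj₂ (ends h y))
  ends-right y rewrite splitAt-↑ʳ A B y = refl

  Joins-left : ∀ {x u w} → Joins g x u w → Joins X (left x) (u ↑ˡ Q) (w ↑ˡ Q)
  Joins-left {x} (inj₁ refl) = inj₁ (ends-left x)
  Joins-left {x} (inj₂ refl) = inj₂ (ends-left x)

  Joins-right : ∀ {y u w} → Joins h y u w → Joins X (right y) (P ↑ʳ u) (P ↑ʳ w)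
  Joins-right {y} (inj₁ refl) = inj₁ (ends-right y)
  Joins-right {y} (inj₂ refl) = inj₂ (ends-right y)

  part : Edge X → Part
  part F.zero    = stemᵖ
  part (F.suc k) = [ const leftᵖ , const rightᵖ ]′ (splitAt A k)

  part-left : ∀ x → part (left x) ≡ leftᵖ
  part-left x rewrite splitAt-↑ˡ A x B = refl

  part-right : ∀ y → part (right y) ≡ rightᵖ
  part-right y rewrite splitAt-↑ʳ A B y = refl

  left-nonstem : ∀ x → part (left x) ≢ stemᵖ
  left-nonstem x eq = contradiction (trans (sym (part-left x)) eq) λ ()

  right-nonstem : ∀ y → part (right y) ≢ stemᵖ
  right-nonstem y eq = contradiction (trans (sym (part-right y)) eq) λ ()

  part≡stem : ∀ {e} → part e ≡ stemᵖ → e ≡ stem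
  part≡stem {e} eq with edgeView e
  ... | stemᵛ    = refl
  ... | leftᵛ x  = contradiction eq (left-nonstem x)
  ... | rightᵛ y = contradiction eq (right-nonstem y)

  side : Vertex X → Part
  side v = [ const leftᵖ , const rightᵖ ]′ (splitAt P v)

  ends-side : ∀ e → part e ≢ stemᵖ →
              side (proj₁ (ends X e)) ≡ part e × side (proj₂ (ends X e)) ≡ part e
  ends-side e e≢stem with edgeView e
  ... | stemᵛ = contradiction refl e≢stem
  ... | leftᵛ x rewrite ends-left x | part-left x
        | splitAt-↑ˡ P (proj₁ (ends g x)) Q | splitAt-↑ˡ P (proj₂ (ends g x)) Q = refl , refl
  ... | rightᵛ y rewrite ends-right y | part-right y
        | splitAt-↑ʳ P Q (proj₁ (ends h y)) | splitAt-↑ʳ P Q (proj₂ (ends h y)) = refl , refl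

  Joins-side : ∀ {e u w} → Joins X e u w → part e ≢ stemᵖ → side u ≡ part e × side w ≡ part e
  Joins-side {e} (inj₁ refl) e≢stem = ends-side e e≢stem
  Joins-side {e} (inj₂ refl) e≢stem = proj₂ (ends-side e e≢stem) , proj₁ (ends-side e e≢stem)

  Adjacent-part : ∀ {e e′} → Adjacent X e e′ → part e ≢ stemᵖ → part e′ ≢ stemᵖ →
                  part e ≡ part e′
  Adjacent-part {e} {e′} (adjacent {u} {w} {z} j j′) e≢stem e′≢stem =
    trans (sym (proj₂ (Joins-side {e} {u} {w} j e≢stem)))
          (proj₁ (Joins-side {e′} {w} {z} j′ e′≢stem))

  left-right-nonadjacent : ∀ {x y} → ¬ Adjacent X (left x) (right y)
  left-right-nonadjacent {x} {y} adj = contradiction (begin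
    leftᵖ            ≡⟨ part-left x ⟨
    part (left x)    ≡⟨ Adjacent-part adj (left-nonstem x) (right-nonstem y) ⟩
    part (right y)   ≡⟨ part-right y ⟩
    rightᵖ           ∎) λ ()
    where open ≡-Reasoning

  module _ (atG : EdgesAtPoint G) (atH : EdgesAtPoint H) where

    left-at-point : ∀ x → Joins X (left x) (point G ↑ˡ Q) (proj₂ (ends g x) ↑ˡ Q)
    left-at-point x = subst (λ v → Joins X (left x) (v ↑ˡ Q) (proj₂ (ends g x) ↑ˡ Q))
      (atG x) (Joins-left (inj₁ refl))

    right-at-point : ∀ y → Joins X (right y) (P ↑ʳ point H) (P ↑ʳ proj₂ (ends h y))
    right-at-point y = subst (λ v → Joins X (right y) (P ↑ʳ v) (P ↑ʳ proj₂ (ends h y)))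
      (atH y) (Joins-right (inj₁ refl))

    stem-adjacent : ∀ e → Adjacent X stem e
    stem-adjacent e with edgeView e
    ... | stemᵛ    = adjacent (inj₁ refl) (inj₂ refl)
    ... | leftᵛ x  = adjacent (inj₂ refl) (left-at-point x)
    ... | rightᵛ y = adjacent (inj₁ refl) (right-at-point y)

    samePart-adjacent : ∀ {e e′} → part e ≡ part e′ → part e ≢ stemᵖ → Adjacent X e e′
    samePart-adjacent {e} {e′} same e≢stem with edgeView e | edgeView e′
    ... | stemᵛ    | _         = contradiction refl e≢stem
    ... | leftᵛ x  | leftᵛ x′  = adjacent (Joins-sym {X} (left-at-point x)) (left-at-point x′)
    ... | rightᵛ y | rightᵛ y′ = adjacent (Joins-sym {X} (right-at-point y)) (right-at-point y′)
    ... | leftᵛ x  | stemᵛ     = contradiction (trans (sym same) (part-left x)) λ ()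
    ... | leftᵛ x  | rightᵛ y  = contradiction (trans (sym (part-left x)) (trans same (part-right y))) λ ()
    ... | rightᵛ y | stemᵛ     = contradiction (trans (sym same) (part-right y)) λ ()
    ... | rightᵛ y | leftᵛ x   = contradiction (trans (sym (part-right y)) (trans same (part-left x))) λ ()

module _ {G G′ H H′ : Pointed} where
  private
    module S  = StemStructure G H
    module S′ = StemStructure G′ H′

  stemIso : PointedIso G G′ → PointedIso H H′ → Iso (Stem G H) (Stem G′ H′)
  stemIso f g = record
    { φ = φ (iso f) ⊕ₚ φ (iso g) ; ψ = lift₀ (ψ (iso f) ⊕ₚ ψ (iso g)) ; inc = incidence }
    where
    incidence : ∀ e → Joins (Stem G′ H′) (lift₀ (ψ (iso f) ⊕ₚ ψ (iso g)) ⟨$⟩ʳ e)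
                  ((φ (iso f) ⊕ₚ φ (iso g)) ⟨$⟩ʳ proj₁ (ends (Stem G H) e))
                  ((φ (iso f) ⊕ₚ φ (iso g)) ⟨$⟩ʳ proj₂ (ends (Stem G H) e))
    incidence e with S.edgeView e
    ... | S.stemᵛ rewrite ⊕ₚ-↑ˡ (φ (iso f)) (φ (iso g)) (point G)
                        | ⊕ₚ-↑ʳ (φ (iso f)) (φ (iso g)) (point H)
                        | point-preserved f | point-preserved g = inj₁ refl
    ... | S.leftᵛ x rewrite ⊕ₚ-↑ˡ (ψ (iso f)) (ψ (iso g)) x | S.ends-left x
                        | ⊕ₚ-↑ˡ (φ (iso f)) (φ (iso g)) (proj₁ (ends (graph G) x))
                        | ⊕ₚ-↑ˡ (φ (iso f)) (φ (iso g)) (proj₂ (ends (graph G) x)) =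
                          S′.Joins-left (inc (iso f) x)
    ... | S.rightᵛ y rewrite ⊕ₚ-↑ʳ (ψ (iso f)) (ψ (iso g)) y | S.ends-right y
                        | ⊕ₚ-↑ʳ (φ (iso f)) (φ (iso g)) (proj₁ (ends (graph H) y))
                        | ⊕ₚ-↑ʳ (φ (iso f)) (φ (iso g)) (proj₂ (ends (graph H) y)) =
                          S′.Joins-right (inc (iso g) y)

module _ {G H : Pointed} where
  private
    module S  = StemStructure G H
    module S′ = StemStructure H G

  stemSwap : Iso (Stem G H) (Stem H G)
  stemSwap = record { φ = swapₚ S.P S.Q ; ψ = lift₀ (swapₚ S.A S.B) ; inc = incidence }
    where
    incidence : ∀ e → Joins (Stem H G) (lift₀ (swapₚ S.A S.B) ⟨$⟩ʳ e)
                  (swapₚ S.P S.Q ⟨$⟩ʳ proj₁ (ends (Stem G H) e))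
                  (swapₚ S.P S.Q ⟨$⟩ʳ proj₂ (ends (Stem G H) e))
    incidence e with S.edgeView e
    ... | S.stemᵛ rewrite swapₚ-↑ˡ S.Q (point G) | swapₚ-↑ʳ S.P (point H) = inj₂ refl
    ... | S.leftᵛ x rewrite swapₚ-↑ˡ S.B x | S.ends-left x
                        | swapₚ-↑ˡ S.Q (proj₁ (ends (graph G) x))
                        | swapₚ-↑ˡ S.Q (proj₂ (ends (graph G) x)) =
                          S′.Joins-right (inj₁ refl)
    ... | S.rightᵛ y rewrite swapₚ-↑ʳ S.A y | S.ends-right y
                        | swapₚ-↑ʳ S.P (proj₁ (ends (graph H) y))
                        | swapₚ-↑ʳ S.P (proj₂ (ends (graph H) y)) =
                          S′.Joins-left (inj₁ refl)

-- The invariant: edges of each side labelled before the stem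

_≟ᵖ_ : DecidableEquality Part
stemᵖ  ≟ᵖ stemᵖ  = yes refl
stemᵖ  ≟ᵖ leftᵖ  = no λ ()
stemᵖ  ≟ᵖ rightᵖ = no λ ()
leftᵖ  ≟ᵖ stemᵖ  = no λ ()
leftᵖ  ≟ᵖ leftᵖ  = yes refl
leftᵖ  ≟ᵖ rightᵖ = no λ ()
rightᵖ ≟ᵖ stemᵖ  = no λ ()
rightᵖ ≟ᵖ leftᵖ  = no λ ()
rightᵖ ≟ᵖ rightᵖ = yes refl

swapᵖ : Part → Part
swapᵖ stemᵖ  = stemᵖ
swapᵖ leftᵖ  = rightᵖ
swapᵖ rightᵖ = leftᵖ

swapᵖ-injective : ∀ {p q} → swapᵖ p ≡ swapᵖ q → p ≡ q
swapᵖ-injective {stemᵖ}  {stemᵖ}  _ = refl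
swapᵖ-injective {leftᵖ}  {leftᵖ}  _ = refl
swapᵖ-injective {rightᵖ} {rightᵖ} _ = refl
swapᵖ-injective {stemᵖ}  {leftᵖ}  ()
swapᵖ-injective {stemᵖ}  {rightᵖ} ()
swapᵖ-injective {leftᵖ}  {stemᵖ}  ()
swapᵖ-injective {leftᵖ}  {rightᵖ} ()
swapᵖ-injective {rightᵖ} {stemᵖ}  ()
swapᵖ-injective {rightᵖ} {leftᵖ}  ()

partMap : Part → Part → Part → Part
partMap pL pR stemᵖ  = stemᵖ
partMap pL pR leftᵖ  = pL
partMap pL pR rightᵖ = pR

module StemInvariant (G H : Pointed) where

  open StemStructure G H

  countBeforeStem : Labeling X → Part → ℕ
  countBeforeStem τ p = count (λ e → (part e ≟ᵖ p) ×-dec (label τ e <? label τ stem))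

  count-edges : ∀ {ℓ} {R : Pred (Edge X) ℓ} (R? : Decidable R) →
                count R? ≡ indicator (R? stem) + (count (R? ∘ left) + count (R? ∘ right))
  count-edges R? = cong (indicator (R? stem) +_) (count-+ {m = A} {n = B} (R? ∘ F.suc))

  partSize : ∀ {ℓ} {R : Pred Part ℓ} → Decidable R → ℕ
  partSize R? =
    indicator (R? stemᵖ) + ((if does (R? leftᵖ) then A else 0) + (if does (R? rightᵖ) then B else 0))

  count-part : ∀ {ℓ} {R : Pred Part ℓ} (R? : Decidable R) → count (R? ∘ part) ≡ partSize R?
  count-part {R = R} R? = trans (count-edges (R? ∘ part))
    (cong (indicator (R? stemᵖ) +_) (cong₂ _+_
      (trans (count-cong (R? ∘ part ∘ left) (λ _ → R? leftᵖ)
               (λ {x} → subst R (part-left x)) (λ {x} → subst R (sym (part-left x))))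
             (count-const {n = A} (R? leftᵖ)))
      (trans (count-cong (R? ∘ part ∘ right) (λ _ → R? rightᵖ)
               (λ {y} → subst R (part-right y)) (λ {y} → subst R (sym (part-right y))))
             (count-const {n = B} (R? rightᵖ)))))

  count-onLeft : ∀ {ℓ} {R : Pred (Edge X) ℓ} (R? : Decidable R) →
                 (∀ {e} → R e → part e ≡ leftᵖ) → count R? ≡ count (R? ∘ left)
  count-onLeft R? onLeft = begin
    count R?                                                        ≡⟨ count-edges R? ⟩
    indicator (R? stem) + (count (R? ∘ left) + count (R? ∘ right))
      ≡⟨ cong₂ _+_ (indicator-no (R? stem) (λ r → contradiction (onLeft r) λ ()))
                   (cong (count (R? ∘ left) +_) (count-none (R? ∘ right)
                      (λ y r → contradiction (trans (sym (onLeft r)) (part-right y)) λ ()))) ⟩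
    count (R? ∘ left) + 0                                           ≡⟨ +-identityʳ _ ⟩
    count (R? ∘ left)                                               ∎
    where open ≡-Reasoning

  count-onRight : ∀ {ℓ} {R : Pred (Edge X) ℓ} (R? : Decidable R) →
                  (∀ {e} → R e → part e ≡ rightᵖ) → count R? ≡ count (R? ∘ right)
  count-onRight R? onRight = begin
    count R?                                                        ≡⟨ count-edges R? ⟩
    indicator (R? stem) + (count (R? ∘ left) + count (R? ∘ right))
      ≡⟨ cong₂ _+_ (indicator-no (R? stem) (λ r → contradiction (onRight r) λ ()))
                   (cong (_+ count (R? ∘ right)) (count-none (R? ∘ left)
                      (λ x r → contradiction (trans (sym (onRight r)) (part-left x)) λ ()))) ⟩
    count (R? ∘ right)                                              ∎
    where open ≡-Reasoning

  module _ (atG : EdgesAtPoint G) (atH : EdgesAtPoint H) (a₀ : Fin A) (b₀ : Fin B) where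

    module Automorphism (f : Iso X X) where

      private
        ψ′ : Edge X → Edge X
        ψ′ = ψ f ⟨$⟩ʳ_

      stem-image-adjacent : ∀ e → Adjacent X (ψ′ stem) e
      stem-image-adjacent e = subst (Adjacent X (ψ′ stem)) (inverseʳ (ψ f))
        (Iso-Adjacent f (stem-adjacent atG atH (ψ f ⟨$⟩ˡ e)))

      -- Otherwise the image of the stem would lie on one side while being
      -- adjacent to an edge of each side.
      fixes-stem : ψ′ stem ≡ stem
      fixes-stem with part (ψ′ stem) ≟ᵖ stemᵖ
      ... | yes eq = part≡stem eq
      ... | no ne  = contradiction (begin
        leftᵖ            ≡⟨ part-left a₀ ⟨
        part (left a₀)   ≡⟨ Adjacent-part (stem-image-adjacent (left a₀)) ne (left-nonstem a₀) ⟨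
        part (ψ′ stem)   ≡⟨ Adjacent-part (stem-image-adjacent (right b₀)) ne (right-nonstem b₀) ⟩
        part (right b₀)  ≡⟨ part-right b₀ ⟩
        rightᵖ           ∎) λ ()
        where open ≡-Reasoning

      image-nonstem : ∀ {e} → part e ≢ stemᵖ → part (ψ′ e) ≢ stemᵖ
      image-nonstem {e} e≢stem eq =
        e≢stem (cong part (⟨$⟩ʳ-injective (ψ f) (trans (part≡stem eq) (sym fixes-stem))))

      image-samePart : ∀ {e e′} → part e ≡ part e′ → part e ≢ stemᵖ → part (ψ′ e) ≡ part (ψ′ e′)
      image-samePart same e≢stem =
        Adjacent-part (Iso-Adjacent f (samePart-adjacent atG atH same e≢stem))
          (image-nonstem e≢stem) (image-nonstem (e≢stem ∘ trans same))

      image-part : ∀ e → part (ψ′ e) ≡ partMap (part (ψ′ (left a₀))) (part (ψ′ (right b₀))) (part e)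
      image-part e with edgeView e
      ... | stemᵛ    = cong part fixes-stem
      ... | leftᵛ x  rewrite part-left x  =
        image-samePart (trans (part-left x) (sym (part-left a₀))) (left-nonstem x)
      ... | rightᵛ y rewrite part-right y =
        image-samePart (trans (part-right y) (sym (part-right b₀))) (right-nonstem y)

      partSize-image : ∀ σ → (∀ e → part (ψ′ e) ≡ σ (part e)) → ∀ p →
                       partSize (_≟ᵖ p) ≡ partSize ((_≟ᵖ p) ∘ σ)
      partSize-image σ img p = begin
        partSize (_≟ᵖ p)              ≡⟨ count-part (_≟ᵖ p) ⟨
        count ((_≟ᵖ p) ∘ part)        ≡⟨ count-permute ((_≟ᵖ p) ∘ part) (ψ f) ⟩
        count ((_≟ᵖ p) ∘ part ∘ ψ′)
          ≡⟨ count-cong ((_≟ᵖ p) ∘ part ∘ ψ′) ((_≟ᵖ p) ∘ σ ∘ part)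
               (λ {e} eq → trans (sym (img e)) eq) (λ {e} eq → trans (img e) eq) ⟩
        count ((_≟ᵖ p) ∘ σ ∘ part)    ≡⟨ count-part ((_≟ᵖ p) ∘ σ) ⟩
        partSize ((_≟ᵖ p) ∘ σ)        ∎
        where open ≡-Reasoning

      -- Sending both sides to the same side would change the size of that
      -- side, which partSize-image forbids.
      automorphism-parts :
        (∀ e → part (ψ′ e) ≡ part e) ⊎ (A ≡ B × ∀ e → part (ψ′ e) ≡ swapᵖ (part e))
      automorphism-parts with part (ψ′ (left a₀)) | part (ψ′ (right b₀)) | image-part
                            | image-nonstem (left-nonstem a₀) | image-nonstem (right-nonstem b₀)
      ... | stemᵖ  | _      | _   | ≢stem | _     = contradiction refl ≢stem
      ... | _      | stemᵖ  | _   | _     | ≢stem = contradiction refl ≢stem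
      ... | leftᵖ  | rightᵖ | img | _     | _     = inj₁ λ e → trans (img e) (partMap-id (part e))
        where
        partMap-id : ∀ p → partMap leftᵖ rightᵖ p ≡ p
        partMap-id stemᵖ  = refl
        partMap-id leftᵖ  = refl
        partMap-id rightᵖ = refl
      ... | rightᵖ | leftᵖ  | img | _     | _     =
        inj₂ (A≡B , λ e → trans (img e) (partMap-swap (part e)))
        where
        partMap-swap : ∀ p → partMap rightᵖ leftᵖ p ≡ swapᵖ p
        partMap-swap stemᵖ  = refl
        partMap-swap leftᵖ  = refl
        partMap-swap rightᵖ = refl
        A≡B : A ≡ B
        A≡B = trans (sym (+-identityʳ A)) (partSize-image (partMap rightᵖ leftᵖ) img leftᵖ)
      ... | leftᵖ  | leftᵖ  | img | _     | _     =
        contradiction A≡A+B (<⇒≢ (m<m+n A (≤-<-trans z≤n (FP.toℕ<n b₀))))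
        where
        A≡A+B : A ≡ A + B
        A≡A+B = trans (sym (+-identityʳ A)) (partSize-image (partMap leftᵖ leftᵖ) img leftᵖ)
      ... | rightᵖ | rightᵖ | img | _     | _     =
        contradiction (partSize-image (partMap rightᵖ rightᵖ) img rightᵖ)
          (<⇒≢ (m<n+m B (≤-<-trans z≤n (FP.toℕ<n a₀))))

    module _ {τ ρ : Labeling X} (f : Iso X X) (maps : MapsTemporalPaths X τ ρ f) where

      open Automorphism f

      private
        ψ′ : Edge X → Edge X
        ψ′ = ψ f ⟨$⟩ʳ_

      before-image : ∀ e → label τ e < label τ stem → label ρ (ψ′ e) < label ρ stem
      before-image e lt = subst (λ s → label ρ (ψ′ e) < label ρ s) fixes-stem
        (temporalPaths⇒adjacentOrder {τ = τ} {ρ} f maps (Adjacent-sym (stem-adjacent atG atH e)) lt)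

      before-preimage : ∀ e → label ρ (ψ′ e) < label ρ stem → label τ e < label τ stem
      before-preimage e lt with <-cmp (label τ e) (label τ stem)
      ... | tri< before _ _ = before
      ... | tri≈ _ same _ = contradiction
        (subst (λ s → label ρ s < label ρ stem) (trans (cong ψ′ (label-injective τ same)) fixes-stem) lt)
        (<-irrefl refl)
      ... | tri> _ _ after = contradiction
        (subst (λ s → label ρ s < label ρ (ψ′ e)) fixes-stem
          (temporalPaths⇒adjacentOrder {τ = τ} {ρ} f maps (stem-adjacent atG atH e) after))
        (<-asym lt)

      countBeforeStem-transfer : (σ : Part → Part) → (∀ {p q} → σ p ≡ σ q → p ≡ q) →
        (∀ e → part (ψ′ e) ≡ σ (part e)) → ∀ p → countBeforeStem τ p ≡ countBeforeStem ρ (σ p)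
      countBeforeStem-transfer σ σ-injective img p = begin
        countBeforeStem τ p
          ≡⟨ count-cong (λ e → (part e ≟ᵖ p) ×-dec (label τ e <? label τ stem)) image? to from ⟩
        count image?
          ≡⟨ count-permute (λ e → (part e ≟ᵖ σ p) ×-dec (label ρ e <? label ρ stem)) (ψ f) ⟨
        countBeforeStem ρ (σ p)
          ∎
        where
        open ≡-Reasoning
        image? = λ e → (part (ψ′ e) ≟ᵖ σ p) ×-dec (label ρ (ψ′ e) <? label ρ stem)
        to : ∀ {e} → part e ≡ p × label τ e < label τ stem →
             part (ψ′ e) ≡ σ p × label ρ (ψ′ e) < label ρ stem
        to {e} (same , lt) = trans (img e) (cong σ same) , before-image e lt
        from : ∀ {e} → part (ψ′ e) ≡ σ p × label ρ (ψ′ e) < label ρ stem →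
               part e ≡ p × label τ e < label τ stem
        from {e} (same , lt) = σ-injective (trans (sym (img e)) same) , before-preimage e lt

    ≅ₜ-countBeforeStem : ∀ {τ ρ} → TemporallyIsomorphic X τ ρ →
      (countBeforeStem τ leftᵖ ≡ countBeforeStem ρ leftᵖ ×
       countBeforeStem τ rightᵖ ≡ countBeforeStem ρ rightᵖ) ⊎
      (A ≡ B × countBeforeStem τ leftᵖ ≡ countBeforeStem ρ rightᵖ ×
               countBeforeStem τ rightᵖ ≡ countBeforeStem ρ leftᵖ)
    ≅ₜ-countBeforeStem {τ} {ρ} (f , maps) with Automorphism.automorphism-parts f
    ... | inj₁ preserved = inj₁ (transfer leftᵖ , transfer rightᵖ)
      where transfer = countBeforeStem-transfer {τ} {ρ} f maps (λ p → p) (λ eq → eq) preserved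
    ... | inj₂ (A≡B , swapped) = inj₂ (A≡B , transfer leftᵖ , transfer rightᵖ)
      where transfer = countBeforeStem-transfer {τ} {ρ} f maps swapᵖ swapᵖ-injective swapped

-- Canonical labelings

phase : ∀ {n} → ℕ → Fin n → ℕ
phase i x with toℕ x <? i
... | yes _ = 0
... | no _  = 2

phase-< : ∀ {n i} {x : Fin n} → toℕ x < i → phase i x ≡ 0
phase-< {i = i} {x} lt with toℕ x <? i
... | yes _  = refl
... | no ¬lt = contradiction lt ¬lt

phase-≥ : ∀ {n i} {x : Fin n} → i ≤ toℕ x → phase i x ≡ 2
phase-≥ {i = i} {x} ge with toℕ x <? i
... | yes lt = contradiction ge (<⇒≱ lt)
... | no _   = refl

phase<1⇒ : ∀ {n i} {x : Fin n} → phase i x < 1 → toℕ x < i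
phase<1⇒ {i = i} {x} lt = decidable-stable (toℕ x <? i) λ ¬below →
  contradiction (subst (_< 1) (phase-≥ (≮⇒≥ ¬below)) lt) λ { (s≤s ()) }

phase-mono : ∀ {n i} {x y : Fin n} → toℕ x ≤ toℕ y → phase i x ≤ phase i y
phase-mono {i = i} {x} {y} le with toℕ x <? i | toℕ y <? i
... | yes _ | _      = z≤n
... | no ¬x | yes y< = contradiction (≤-<-trans le y<) ¬x
... | no _  | no _   = ≤-refl

phase≢1 : ∀ {n i} (x : Fin n) → phase i x ≢ 1
phase≢1 {i = i} x with toℕ x <? i
... | yes _ = λ ()
... | no _  = λ ()

module Canonical (G H : Pointed) where

  open StemStructure G H
  open StemInvariant G H

  -- canon i j labels, in this order: the first i edges of G and the first j
  -- edges of H (key 0), the stem (key 1), then the remaining edges (key 2);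
  -- edges with equal keys are labelled in index order.
  canonKey : ℕ → ℕ → Edge X → ℕ
  canonKey i j F.zero    = 1
  canonKey i j (F.suc k) = [ phase i , phase j ]′ (splitAt A k)

  key-left : ∀ i j x → canonKey i j (left x) ≡ phase i x
  key-left i j x rewrite splitAt-↑ˡ A x B = refl

  key-right : ∀ i j y → canonKey i j (right y) ≡ phase j y
  key-right i j y rewrite splitAt-↑ʳ A B y = refl

  canon : ℕ → ℕ → Labeling X
  canon i j = Rank.rankPerm (canonKey i j)

  module _ {i j : ℕ} where
    open Rank (canonKey i j)

    canon-before⇒ : ∀ {e} → label (canon i j) e < label (canon i j) stem → canonKey i j e < 1
    canon-before⇒ {e} lt with rankPerm-reflects {e} {stem} lt
    ... | inj₁ key< = key<
    ... | inj₂ (_ , ())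

    canon-before⇐ : ∀ {e} → canonKey i j e < 1 → label (canon i j) e < label (canon i j) stem
    canon-before⇐ {e} key< = rankPerm-mono {e} {stem} (inj₁ key<)

    countBeforeStem-canon : i ≤ A → j ≤ B →
      countBeforeStem (canon i j) leftᵖ ≡ i × countBeforeStem (canon i j) rightᵖ ≡ j
    countBeforeStem-canon i≤A j≤B =
      trans (count-onLeft (before? leftᵖ) proj₁)
        (trans (count-cong (before? leftᵖ ∘ left) (λ x → toℕ x <? i) onLeft offLeft) (count-toℕ< i≤A)) ,
      trans (count-onRight (before? rightᵖ) proj₁)
        (trans (count-cong (before? rightᵖ ∘ right) (λ y → toℕ y <? j) onRight offRight) (count-toℕ< j≤B))
      where
      before? = λ p e → (part e ≟ᵖ p) ×-dec (label (canon i j) e <? label (canon i j) stem)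
      onLeft : ∀ {x} → part (left x) ≡ leftᵖ × label (canon i j) (left x) < label (canon i j) stem →
               toℕ x < i
      onLeft {x} (_ , lt) = phase<1⇒ (subst (_< 1) (key-left i j x) (canon-before⇒ lt))
      offLeft : ∀ {x} → toℕ x < i →
                part (left x) ≡ leftᵖ × label (canon i j) (left x) < label (canon i j) stem
      offLeft {x} lt =
        part-left x , canon-before⇐ (subst (_< 1) (sym (trans (key-left i j x) (phase-< lt))) (s≤s z≤n))
      onRight : ∀ {y} → part (right y) ≡ rightᵖ × label (canon i j) (right y) < label (canon i j) stem →
                toℕ y < j
      onRight {y} (_ , lt) = phase<1⇒ (subst (_< 1) (key-right i j y) (canon-before⇒ lt))
      offRight : ∀ {y} → toℕ y < j →
                 part (right y) ≡ rightᵖ × label (canon i j) (right y) < label (canon i j) stem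
      offRight {y} lt =
        part-right y , canon-before⇐ (subst (_< 1) (sym (trans (key-right i j y) (phase-< lt))) (s≤s z≤n))

    left-≺ : ∀ {a b} → toℕ a < toℕ b → left a ≺ left b
    left-≺ {a} {b} a<b = ≤∧<⇒≺
      (subst₂ _≤_ (sym (key-left i j a)) (sym (key-left i j b)) (phase-mono (<⇒≤ a<b)))
      (s≤s (subst₂ _<_ (sym (FP.toℕ-↑ˡ a B)) (sym (FP.toℕ-↑ˡ b B)) a<b))

    right-≺ : ∀ {a b} → toℕ a < toℕ b → right a ≺ right b
    right-≺ {a} {b} a<b = ≤∧<⇒≺
      (subst₂ _≤_ (sym (key-right i j a)) (sym (key-right i j b)) (phase-mono (<⇒≤ a<b)))
      (s≤s (subst₂ _<_ (sym (FP.toℕ-↑ʳ A a)) (sym (FP.toℕ-↑ʳ A b)) (+-monoʳ-< A a<b)))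

    stem-≺-left : ∀ {a} → i ≤ toℕ a → stem ≺ left a
    stem-≺-left {a} i≤a =
      inj₁ (subst (1 <_) (sym (trans (key-left i j a) (phase-≥ i≤a))) (s≤s (s≤s z≤n)))

    left-≺-stem : ∀ {a} → toℕ a < i → left a ≺ stem
    left-≺-stem {a} a<i = inj₁ (subst (_< 1) (sym (trans (key-left i j a) (phase-< a<i))) (s≤s z≤n))

    stem-≺-right : ∀ {a} → j ≤ toℕ a → stem ≺ right a
    stem-≺-right {a} j≤a =
      inj₁ (subst (1 <_) (sym (trans (key-right i j a) (phase-≥ j≤a))) (s≤s (s≤s z≤n)))

    right-≺-stem : ∀ {a} → toℕ a < j → right a ≺ stem
    right-≺-stem {a} a<j = inj₁ (subst (_< 1) (sym (trans (key-right i j a) (phase-< a<j))) (s≤s z≤n))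

  leftBeforeStem : Labeling X → ℕ
  leftBeforeStem τ = count (λ x → label τ (left x) <? label τ stem)

  rightBeforeStem : Labeling X → ℕ
  rightBeforeStem τ = count (λ y → label τ (right y) <? label τ stem)

  module _ (τ : Labeling X) where
    private
      module L = Rank (λ x → label τ (left x))
      module R = Rank (λ y → label τ (right y))
    open Rank (canonKey (leftBeforeStem τ) (rightBeforeStem τ))

    rank-ordered : (h : Edge X → Edge X) → h stem ≡ stem →
                   (∀ x → h (left x) ≡ left (L.rankPerm ⟨$⟩ʳ x)) →
                   (∀ y → h (right y) ≡ right (R.rankPerm ⟨$⟩ʳ y)) →
                   ∀ {e e′} → Adjacent X e e′ → label τ e < label τ e′ → h e ≺ h e′
    rank-ordered h h-stem h-left h-right {e} {e′} adj lt with edgeView e | edgeView e′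
    ... | stemᵛ    | stemᵛ     = contradiction lt (<-irrefl refl)
    ... | stemᵛ    | leftᵛ x   =
      subst₂ _≺_ (sym h-stem) (sym (h-left x)) (stem-≺-left (L.rankPerm-above (<⇒≤ lt)))
    ... | stemᵛ    | rightᵛ y  =
      subst₂ _≺_ (sym h-stem) (sym (h-right y)) (stem-≺-right (R.rankPerm-above (<⇒≤ lt)))
    ... | leftᵛ x  | stemᵛ     =
      subst₂ _≺_ (sym (h-left x)) (sym h-stem) (left-≺-stem (L.rankPerm-below lt))
    ... | rightᵛ y | stemᵛ     =
      subst₂ _≺_ (sym (h-right y)) (sym h-stem) (right-≺-stem (R.rankPerm-below lt))
    ... | leftᵛ x  | leftᵛ x′  =
      subst₂ _≺_ (sym (h-left x)) (sym (h-left x′)) (left-≺ (L.rankPerm-mono (inj₁ lt)))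
    ... | rightᵛ y | rightᵛ y′ =
      subst₂ _≺_ (sym (h-right y)) (sym (h-right y′)) (right-≺ (R.rankPerm-mono (inj₁ lt)))
    ... | leftᵛ x  | rightᵛ y  = contradiction adj left-right-nonadjacent
    ... | rightᵛ y | leftᵛ x   = contradiction (Adjacent-sym adj) left-right-nonadjacent

  ≅ₜ-canon : EdgeSymmetric G → EdgeSymmetric H → ∀ τ →
             TemporallyIsomorphic X τ (canon (leftBeforeStem τ) (rightBeforeStem τ))
  ≅ₜ-canon symG symH τ =
    f , adjacentOrder⇒temporalPaths {τ = τ} {canon (leftBeforeStem τ) (rightBeforeStem τ)} f
          λ {e} {e′} adj lt → rankPerm-mono {ψ f ⟨$⟩ʳ e} {ψ f ⟨$⟩ʳ e′}
            (rank-ordered τ (ψ f ⟨$⟩ʳ_) refl ψ-left ψ-right adj lt)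
    where
    module L = Rank (λ x → label τ (left x))
    module R = Rank (λ y → label τ (right y))
    open Rank (canonKey (leftBeforeStem τ) (rightBeforeStem τ))
    autG = symG L.rankPerm
    autH = symH R.rankPerm
    f : Iso X X
    f = stemIso (proj₁ autG) (proj₁ autH)
    ψ-left : ∀ x → ψ f ⟨$⟩ʳ left x ≡ left (L.rankPerm ⟨$⟩ʳ x)
    ψ-left x = cong F.suc
      (trans (⊕ₚ-↑ˡ (ψ (iso (proj₁ autG))) (ψ (iso (proj₁ autH))) x) (cong (_↑ˡ B) (proj₂ autG x)))
    ψ-right : ∀ y → ψ f ⟨$⟩ʳ right y ≡ right (R.rankPerm ⟨$⟩ʳ y)
    ψ-right y = cong F.suc
      (trans (⊕ₚ-↑ʳ (ψ (iso (proj₁ autG))) (ψ (iso (proj₁ autH))) y) (cong (A ↑ʳ_) (proj₂ autH y)))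

module _ (G : Pointed) where

  open StemStructure G G
  open Canonical G G

  private
    left-index : ∀ {x x′} → left x F.< left x′ → toℕ x < toℕ x′
    left-index {x} {x′} (s≤s lt) = subst₂ _<_ (FP.toℕ-↑ˡ x A) (FP.toℕ-↑ˡ x′ A) lt

    right-index : ∀ {y y′} → right y F.< right y′ → toℕ y < toℕ y′
    right-index {y} {y′} (s≤s lt) = +-cancelˡ-< A _ _ (subst₂ _<_ (FP.toℕ-↑ʳ A y) (FP.toℕ-↑ʳ A y′) lt)

  module _ {i j : ℕ} (h : Edge X → Edge X) (h-stem : h stem ≡ stem)
           (h-left : ∀ x → h (left x) ≡ right x) (h-right : ∀ y → h (right y) ≡ left y) where

    open Rank (canonKey i j) using (_≺_)
    open Rank (canonKey j i) using () renaming (_≺_ to _≺′_)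

    canonKey-swap : ∀ e → canonKey j i (h e) ≡ canonKey i j e
    canonKey-swap e with edgeView e
    ... | stemᵛ    = cong (canonKey j i) h-stem
    ... | leftᵛ x  =
      trans (cong (canonKey j i) (h-left x)) (trans (key-right j i x) (sym (key-left i j x)))
    ... | rightᵛ y =
      trans (cong (canonKey j i) (h-right y)) (trans (key-left j i y) (sym (key-right i j y)))

    swap-ordered : ∀ {e e′} → Adjacent X e e′ → e ≺ e′ → h e ≺′ h e′
    swap-ordered {e} {e′} _ (inj₁ key<) =
      inj₁ (subst₂ _<_ (sym (canonKey-swap e)) (sym (canonKey-swap e′)) key<)
    swap-ordered {e} {e′} adj (inj₂ (key≡ , e<e′)) with edgeView e | edgeView e′
    ... | stemᵛ    | stemᵛ     = contradiction e<e′ λ ()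
    ... | stemᵛ    | leftᵛ x   = contradiction (trans (sym (key-left i j x)) (sym key≡)) (phase≢1 x)
    ... | stemᵛ    | rightᵛ y  = contradiction (trans (sym (key-right i j y)) (sym key≡)) (phase≢1 y)
    ... | leftᵛ x  | stemᵛ     = contradiction (trans (sym (key-left i j x)) key≡) (phase≢1 x)
    ... | rightᵛ y | stemᵛ     = contradiction (trans (sym (key-right i j y)) key≡) (phase≢1 y)
    ... | leftᵛ x  | leftᵛ x′  =
      subst₂ _≺′_ (sym (h-left x)) (sym (h-left x′)) (right-≺ (left-index e<e′))
    ... | rightᵛ y | rightᵛ y′ =
      subst₂ _≺′_ (sym (h-right y)) (sym (h-right y′)) (left-≺ (right-index e<e′))
    ... | leftᵛ x  | rightᵛ y  = contradiction adj left-right-nonadjacent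
    ... | rightᵛ y | leftᵛ x   = contradiction (Adjacent-sym adj) left-right-nonadjacent

  canon-swap : ∀ i j → TemporallyIsomorphic X (canon i j) (canon j i)
  canon-swap i j =
    swap , adjacentOrder⇒temporalPaths {τ = canon i j} {canon j i} swap λ {e} {e′} adj lt →
      Rank.rankPerm-mono (canonKey j i) {ψ′ e} {ψ′ e′}
        (swap-ordered ψ′ refl swapped-left swapped-right adj
          (Rank.rankPerm-reflects (canonKey i j) {e} {e′} lt))
    where
    swap : Iso X X
    swap = stemSwap {G} {G}
    ψ′ : Edge X → Edge X
    ψ′ = ψ swap ⟨$⟩ʳ_
    swapped-left : ∀ x → ψ′ (left x) ≡ right x
    swapped-left x = cong F.suc (swapₚ-↑ˡ A x)
    swapped-right : ∀ y → ψ′ (right y) ≡ left y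
    swapped-right y = cong F.suc (swapₚ-↑ʳ A y)

-- Counting the classes

module Classification (G H : Pointed) (atG : EdgesAtPoint G) (atH : EdgesAtPoint H)
                      (symG : EdgeSymmetric G) (symH : EdgeSymmetric H)
                      (1≤A : 1 ≤ nE (graph G)) (1≤B : 1 ≤ nE (graph H)) where

  open StemStructure G H
  open StemInvariant G H
  open Canonical G H

  canon-≅ₜ : ∀ {i j i′ j′} → i ≤ A → j ≤ B → i′ ≤ A → j′ ≤ B →
             TemporallyIsomorphic X (canon i j) (canon i′ j′) →
             (i ≡ i′ × j ≡ j′) ⊎ (A ≡ B × i ≡ j′ × j ≡ i′)
  canon-≅ₜ {i} {j} {i′} {j′} i≤A j≤B i′≤A j′≤B iso =
    conclude (countBeforeStem-canon i≤A j≤B) (countBeforeStem-canon i′≤A j′≤B)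
      (≅ₜ-countBeforeStem atG atH (fromℕ< 1≤A) (fromℕ< 1≤B) {canon i j} {canon i′ j′} iso)
    where
    conclude : ∀ {a b a′ b′} → a ≡ i × b ≡ j → a′ ≡ i′ × b′ ≡ j′ →
               (a ≡ a′ × b ≡ b′) ⊎ (A ≡ B × a ≡ b′ × b ≡ a′) →
               (i ≡ i′ × j ≡ j′) ⊎ (A ≡ B × i ≡ j′ × j ≡ i′)
    conclude (refl , refl) (refl , refl) same-or-swapped = same-or-swapped

  leftBeforeStem≤A : ∀ τ → leftBeforeStem τ ≤ A
  leftBeforeStem≤A τ = count-≤ (λ x → label τ (left x) <? label τ stem)

  rightBeforeStem≤B : ∀ τ → rightBeforeStem τ ≤ B
  rightBeforeStem≤B τ = count-≤ (λ y → label τ (right y) <? label τ stem)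

  numClasses-≢ : A ≢ B → NumClasses X (suc A * suc B)
  numClasses-≢ A≢B = rep , distinct , complete
    where
    pair : Fin (suc A * suc B) → Fin (suc A) × Fin (suc B)
    pair = remQuot {suc A} (suc B)
    rep : Fin (suc A * suc B) → Labeling X
    rep k = canon (toℕ (proj₁ (pair k))) (toℕ (proj₂ (pair k)))
    bound : ∀ {n} (q : Fin (suc n)) → toℕ q ≤ n
    bound q = ≤-pred (FP.toℕ<n q)
    pair-injective : ∀ {k k′} → toℕ (proj₁ (pair k)) ≡ toℕ (proj₁ (pair k′)) →
                     toℕ (proj₂ (pair k)) ≡ toℕ (proj₂ (pair k′)) → k ≡ k′
    pair-injective {k} {k′} same₁ same₂ = begin
      k                                             ≡⟨ FP.combine-remQuot {suc A} (suc B) k ⟨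
      combine (proj₁ (pair k)) (proj₂ (pair k))
        ≡⟨ cong₂ combine (toℕ-injective same₁) (toℕ-injective same₂) ⟩
      combine (proj₁ (pair k′)) (proj₂ (pair k′))   ≡⟨ FP.combine-remQuot {suc A} (suc B) k′ ⟩
      k′                                            ∎
      where open ≡-Reasoning
    distinct : ∀ k k′ → TemporallyIsomorphic X (rep k) (rep k′) → k ≡ k′
    distinct k k′ iso =
      [ (λ (same₁ , same₂) → pair-injective {k} {k′} same₁ same₂)
      , (λ (A≡B , _) → contradiction A≡B A≢B)
      ]′ (canon-≅ₜ {toℕ (proj₁ (pair k))} {toℕ (proj₂ (pair k))}
                   {toℕ (proj₁ (pair k′))} {toℕ (proj₂ (pair k′))}
                   (bound (proj₁ (pair k))) (bound (proj₂ (pair k)))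
                   (bound (proj₁ (pair k′))) (bound (proj₂ (pair k′))) iso)
    complete : ∀ τ → ∃ λ k → TemporallyIsomorphic X τ (rep k)
    complete τ =
      combine i j , subst (TemporallyIsomorphic X τ) (sym rep-combine) (≅ₜ-canon symG symH τ)
      where
      i = fromℕ< (s≤s (leftBeforeStem≤A τ))
      j = fromℕ< (s≤s (rightBeforeStem≤B τ))
      rep-combine : rep (combine i j) ≡ canon (leftBeforeStem τ) (rightBeforeStem τ)
      rep-combine = cong₂ canon
        (trans (cong (toℕ ∘ proj₁) (FP.remQuot-combine i j)) (toℕ-fromℕ< (s≤s (leftBeforeStem≤A τ))))
        (trans (cong (toℕ ∘ proj₂) (FP.remQuot-combine i j)) (toℕ-fromℕ< (s≤s (rightBeforeStem≤B τ))))

triangle : ℕ → ℕ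
triangle zero    = 1
triangle (suc a) = triangle a + suc (suc a)

diagonalPair : ∀ a → Fin (triangle a) → ℕ × ℕ
diagonalPair zero    _ = 0 , 0
diagonalPair (suc a) k = [ diagonalPair a , (λ y → suc a , toℕ y) ]′ (splitAt (triangle a) k)

diagonalPair-↑ˡ : ∀ a k → diagonalPair (suc a) (k ↑ˡ suc (suc a)) ≡ diagonalPair a k
diagonalPair-↑ˡ a k rewrite splitAt-↑ˡ (triangle a) k (suc (suc a)) = refl

diagonalPair-↑ʳ : ∀ a y → diagonalPair (suc a) (triangle a ↑ʳ y) ≡ (suc a , toℕ y)
diagonalPair-↑ʳ a y rewrite splitAt-↑ʳ (triangle a) (suc (suc a)) y = refl

diagonalPair-bounded : ∀ a k →
  proj₂ (diagonalPair a k) ≤ proj₁ (diagonalPair a k) × proj₁ (diagonalPair a k) ≤ a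
diagonalPair-bounded zero    k = z≤n , z≤n
diagonalPair-bounded (suc a) k with split (triangle a) (suc (suc a)) k
... | inl x rewrite diagonalPair-↑ˡ a x =
  proj₁ (diagonalPair-bounded a x) , m≤n⇒m≤1+n (proj₂ (diagonalPair-bounded a x))
... | inr y rewrite diagonalPair-↑ʳ a y = ≤-pred (FP.toℕ<n y) , ≤-refl

diagonalPair-injective : ∀ a {k k′} → diagonalPair a k ≡ diagonalPair a k′ → k ≡ k′
diagonalPair-injective zero    {F.zero} {F.zero} _ = refl
diagonalPair-injective (suc a) {k} {k′} eq
  with split (triangle a) (suc (suc a)) k | split (triangle a) (suc (suc a)) k′
... | inl x | inl x′ = cong (_↑ˡ suc (suc a))
  (diagonalPair-injective a (trans (sym (diagonalPair-↑ˡ a x)) (trans eq (diagonalPair-↑ˡ a x′))))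
... | inr y | inr y′ = cong (triangle a ↑ʳ_)
  (toℕ-injective (cong proj₂ (trans (sym (diagonalPair-↑ʳ a y)) (trans eq (diagonalPair-↑ʳ a y′)))))
... | inl x | inr y′ = contradiction
  (subst (_≤ a) (cong proj₁ (trans (sym (diagonalPair-↑ˡ a x)) (trans eq (diagonalPair-↑ʳ a y′))))
    (proj₂ (diagonalPair-bounded a x))) 1+n≰n
... | inr y | inl x′ = contradiction
  (subst (_≤ a) (cong proj₁ (trans (sym (diagonalPair-↑ˡ a x′)) (trans (sym eq) (diagonalPair-↑ʳ a y))))
    (proj₂ (diagonalPair-bounded a x′))) 1+n≰n

diagonalPair-surjective : ∀ a {i j} → j ≤ i → i ≤ a → ∃ λ k → diagonalPair a k ≡ (i , j)
diagonalPair-surjective zero    {zero} {zero} _ _ = F.zero , refl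
diagonalPair-surjective (suc a) {i} {j} j≤i i≤1+a with m≤n⇒m<n∨m≡n i≤1+a
... | inj₁ i<1+a with diagonalPair-surjective a j≤i (≤-pred i<1+a)
...   | k , eq = k ↑ˡ suc (suc a) , trans (diagonalPair-↑ˡ a k) eq
diagonalPair-surjective (suc a) {i} {j} j≤i i≤1+a | inj₂ refl =
  triangle a ↑ʳ fromℕ< (s≤s j≤i) , trans (diagonalPair-↑ʳ a _) (cong (suc a ,_) (toℕ-fromℕ< (s≤s j≤i)))

ordered-pair-≡ : ∀ {i j i′ j′ : ℕ} → j ≤ i → j′ ≤ i′ →
                 (i ≡ i′ × j ≡ j′) ⊎ (i ≡ j′ × j ≡ i′) → (i , j) ≡ (i′ , j′)
ordered-pair-≡ _   _     (inj₁ (refl , refl)) = refl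
ordered-pair-≡ j≤i j′≤i′ (inj₂ (refl , refl)) with ≤-antisym j′≤i′ j≤i
... | refl = refl

module _ (G : Pointed) (atG : EdgesAtPoint G) (symG : EdgeSymmetric G) (1≤A : 1 ≤ nE (graph G)) where

  open StemStructure G G
  open Canonical G G
  open Classification G G atG atG symG symG 1≤A 1≤A

  numClasses-≡ : NumClasses X (triangle A)
  numClasses-≡ = rep , distinct , complete
    where
    rep : Fin (triangle A) → Labeling X
    rep k = canon (proj₁ (diagonalPair A k)) (proj₂ (diagonalPair A k))
    distinct : ∀ k k′ → TemporallyIsomorphic X (rep k) (rep k′) → k ≡ k′
    distinct k k′ iso = diagonalPair-injective A (ordered-pair-≡ j≤i j′≤i′
      (map₂ proj₂ (canon-≅ₜ {proj₁ (diagonalPair A k)} {proj₂ (diagonalPair A k)}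
                            {proj₁ (diagonalPair A k′)} {proj₂ (diagonalPair A k′)}
                            i≤A (≤-trans j≤i i≤A) i′≤A (≤-trans j′≤i′ i′≤A) iso)))
      where
      j≤i   = proj₁ (diagonalPair-bounded A k)
      i≤A   = proj₂ (diagonalPair-bounded A k)
      j′≤i′ = proj₁ (diagonalPair-bounded A k′)
      i′≤A  = proj₂ (diagonalPair-bounded A k′)
    represented : ∀ {i j} τ → j ≤ i → i ≤ A → TemporallyIsomorphic X τ (canon i j) →
                  ∃ λ k → TemporallyIsomorphic X τ (rep k)
    represented τ j≤i i≤A iso = proj₁ index ,
      subst (TemporallyIsomorphic X τ) (cong (λ (i , j) → canon i j) (sym (proj₂ index))) iso
      where index = diagonalPair-surjective A j≤i i≤A
    complete : ∀ τ → ∃ λ k → TemporallyIsomorphic X τ (rep k)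
    complete τ =
      [ (λ r≤l → represented {l} {r} τ r≤l (leftBeforeStem≤A τ) (≅ₜ-canon symG symG τ))
      , (λ l<r → represented {r} {l} τ (<⇒≤ l<r) (rightBeforeStem≤B τ)
                   (≅ₜ-trans {X} {τ} {canon l r} {canon r l} (≅ₜ-canon symG symG τ) (canon-swap G l r)))
      ]′ (≤-<-connex r l)
      where
      l = leftBeforeStem τ
      r = rightBeforeStem τ

σβδ-edges : ∀ s k → nE (graph (σβδ s k)) ≡ k
σβδ-edges star      k = refl
σβδ-edges beachball k = refl
σβδ-edges daisy     k = refl

σβδ-edgesAtPoint : ∀ s k → EdgesAtPoint (σβδ s k)
σβδ-edgesAtPoint star      k e = refl
σβδ-edgesAtPoint beachball k e = refl
σβδ-edgesAtPoint daisy     k e = refl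

σβδ-edgeSymmetric : ∀ s k → EdgeSymmetric (σβδ s k)
σβδ-edgeSymmetric star k π = record
  { iso = record { φ = lift₀ π ; ψ = π ; inc = λ _ → inj₁ refl } ; point-preserved = refl } , λ _ → refl
σβδ-edgeSymmetric beachball k π = record
  { iso = record { φ = Perm.id ; ψ = π ; inc = λ _ → inj₁ refl } ; point-preserved = refl } , λ _ → refl
σβδ-edgeSymmetric daisy k π = record
  { iso = record { φ = Perm.id ; ψ = π ; inc = λ _ → inj₁ refl } ; point-preserved = refl } , λ _ → refl

triangle*2 : ∀ a → triangle a * 2 ≡ a * a + 3 * a + 2
triangle*2 zero    = refl
triangle*2 (suc a) = begin
  (triangle a + suc (suc a)) * 2        ≡⟨ *-distribʳ-+ 2 (triangle a) (suc (suc a)) ⟩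
  triangle a * 2 + suc (suc a) * 2      ≡⟨ cong (_+ suc (suc a) * 2) (triangle*2 a) ⟩
  a * a + 3 * a + 2 + suc (suc a) * 2   ≡⟨ step a ⟩
  suc a * suc a + 3 * suc a + 2         ∎
  where
  open ≡-Reasoning
  step : ∀ a → a * a + 3 * a + 2 + suc (suc a) * 2 ≡ suc a * suc a + 3 * suc a + 2
  step = solve-∀

triangle-formula : ∀ a → triangle a ≡ (a ^ 2 + 3 * a + 2) / 2
triangle-formula a = begin
  triangle a                ≡⟨ m*n/n≡m (triangle a) 2 ⟨
  triangle a * 2 / 2        ≡⟨ cong (_/ 2) (triangle*2 a) ⟩
  (a * a + 3 * a + 2) / 2   ≡⟨ cong (λ sq → (sq + 3 * a + 2) / 2) (cong (a *_) (*-identityʳ a)) ⟨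
  (a ^ 2 + 3 * a + 2) / 2   ∎
  where open ≡-Reasoning

suc*suc : ∀ a b → suc a * suc b ≡ a * b + a + b + 1
suc*suc = solve-∀

proposition4 : ∀ (a b : ℕ) → 1 ≤ a → 1 ≤ b →
    (a ≢ b → ∀ (s t : Shape) → NumClasses (Stem (σβδ s a) (σβδ t b)) (a * b + a + b + 1))
    × (a ≡ b → ∀ (s : Shape) → NumClasses (Stem (σβδ s a) (σβδ s a)) ((a ^ 2 + 3 * a + 2) / 2))
proposition4 a b 1≤a 1≤b = different , same
  where
  1≤edges : ∀ s {k} → 1 ≤ k → 1 ≤ nE (graph (σβδ s k))
  1≤edges s {k} = subst (1 ≤_) (sym (σβδ-edges s k))
  different : a ≢ b → ∀ s t → NumClasses (Stem (σβδ s a) (σβδ t b)) (a * b + a + b + 1)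
  different a≢b s t = subst (NumClasses (Stem (σβδ s a) (σβδ t b)))
    (trans (cong₂ (λ m n → suc m * suc n) (σβδ-edges s a) (σβδ-edges t b)) (suc*suc a b))
    (Classification.numClasses-≢ (σβδ s a) (σβδ t b) (σβδ-edgesAtPoint s a) (σβδ-edgesAtPoint t b)
      (σβδ-edgeSymmetric s a) (σβδ-edgeSymmetric t b) (1≤edges s 1≤a) (1≤edges t 1≤b)
      (λ eq → a≢b (trans (sym (σβδ-edges s a)) (trans eq (σβδ-edges t b)))))
  same : a ≡ b → ∀ s → NumClasses (Stem (σβδ s a) (σβδ s a)) ((a ^ 2 + 3 * a + 2) / 2)
  same _ s = subst (NumClasses (Stem (σβδ s a) (σβδ s a)))
    (trans (cong triangle (σβδ-edges s a)) (triangle-formula a))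
    (numClasses-≡ (σβδ s a) (σβδ-edgesAtPoint s a) (σβδ-edgeSymmetric s a) (1≤edges s 1≤a))
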